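{- Assume $\mathsf{CT_Q}$. Let $\mathcal{M}$ be a model of $\mathsf{HA}$. If $\mathcal{M}>\mathbb{N}$, then $\neg\neg\,\exists d:\mathcal{M}.\ \neg\mathsf{Dec}(\lambda n:\mathbb{N}.\ \mathcal{M}\vDash \overline{n}\mid d)$.
   Context: Meta-theory: constructive type theory (Calculus of Inductive Constructions); propositions in an impredicative universe $\mathbb{P}$, $\exists,\lor$ propositional; no classical axioms assumed. For $p:X\to\mathbb{P}$, $\mathsf{Dec}(p)$ means $\exists f:X\to\mathbb{B}.\ \forall x.\ p\,x\leftrightarrow f\,x=\mathsf{tt}$. Arithmetic signature $0,S,+,\times,=$. $\mathsf{HA}$: axioms $\forall x.\, Sx=0\to\bot$; $\forall xy.\, Sx=Sy\to x=y$; $0+x=x$; $(Sx)+y=S(x+y)$; $0\times x=0$; $(Sx)\times y=y+x\times y$; equality axioms (reflexivity, symmetry, transitivity, congruence for $S,+,\times$); induction scheme for every formula; $\vdash$ is intuitionistic natural deduction. $\mathsf{Q}$: same, induction replaced by $\forall x.\, x=0\lor\exists y.\, x=Sy$. A model $\mathcal{M}$ of $\mathsf{HA}$ is a type with interpretations of $0,S,+,\times$, $=$ interpreted as actual equality, satisfying all $\mathsf{HA}$ axioms under Tarski semantics (connectives/quantifiers interpreted type-theoretically). $\overline{n}$ denotes the numeral $S^n0$ and its value in $\mathcal{M}$; $x\mid y:=\exists k.\,x\times k=y$. $\mathsf{std}(e):=\exists n:\mathbb{N}.\ \overline{n}=e$; $\mathcal{M}>\mathbb{N}$ means $\exists e:\mathcal{M}.\neg\mathsf{std}(e)$.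 A formula is $\Delta_1$ if for every substitution $\sigma$ of closed terms $\mathsf{Q}\vdash\varphi[\sigma]$ or $\mathsf{Q}\vdash\neg\varphi[\sigma]$; $\Sigma_1$ if of the form $\exists x_1\dots\exists x_n.\varphi_0$ with $\varphi_0$ $\Delta_1$. $\mathsf{CT_Q}$: for every $f:\mathbb{N}\to\mathbb{N}$ there is a binary $\Sigma_1$-formula $\varphi_f(x,y)$ with $\mathsf{Q}\vdash\forall y.\,\varphi_f(\overline{n},y)\leftrightarrow\overline{f\,n}=y$ for every $n$. -}

module Defs where

open import Level using (Level; _⊔_) renaming (suc to lsuc; zero to lzero)
open import Data.Nat using (ℕ; zero; suc; _<_)
open import Data.Bool using (Bool; true)
open import Data.Product using (Σ; _×_; _,_)
open import Data.Sum using (_⊎_)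
open import Data.Empty using (⊥)
open import Data.Unit using (⊤)
open import Data.List using (List; []; _∷_; map)
open import Data.List.Membership.Propositional using (_∈_)
open import Relation.Binary.PropositionalEquality using (_≡_)
open import Relation.Nullary using (¬_)

-- Propositional truncation (impredicative encoding), modelling the
-- propositional ∃ / ∨ of the meta-theory (they eliminate only into
-- propositions).

isProp : Set → Set
isProp P = (x y : P) → x ≡ y

∥_∥ : ∀ {a} → Set a → Set (lsuc lzero ⊔ a)
∥ A ∥ = ∀ {P : Set} → isProp P → (A → P) → P

∣_∣ : ∀ {a} {A : Set a} → A → ∥ A ∥
∣ x ∣ = λ _ k → k x

Ex : ∀ {a b} (A : Set a) → (A → Set b) → Set (lsuc lzero ⊔ a ⊔ b)
Ex A B = ∥ Σ A B ∥

_∨ₚ_ : ∀ {a b} → Set a → Set b → Set (lsuc lzero ⊔ a ⊔ b)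
A ∨ₚ B = ∥ A ⊎ B ∥

_↔_ : ∀ {a b} → Set a → Set b → Set (a ⊔ b)
A ↔ B = (A → B) × (B → A)

Decₚ : ∀ {a b} {X : Set a} → (X → Set b) → Set (lsuc lzero ⊔ a ⊔ b)
Decₚ {X = X} p = Ex (X → Bool) (λ f → ∀ x → p x ↔ (f x ≡ true))

data Term : Set where
  var  : ℕ → Term
  zro  : Term
  S    : Term → Term
  _⊕_  : Term → Term → Term
  _⊗_  : Term → Term → Term

infixl 6 _⊕_
infixl 7 _⊗_
infix  4 _==_
infixr 3 _∧'_
infixr 2 _∨'_
infixr 1 _⇒_

data Form : Set where
  ⊥'   : Form
  _==_ : Term → Term → Form
  _∧'_ : Form → Form → Form
  _∨'_ : Form → Form → Form
  _⇒_  : Form → Form → Form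
  ∀'   : Form → Form
  ∃'   : Form → Form

¬' : Form → Form
¬' φ = φ ⇒ ⊥'

_⇔_ : Form → Form → Form
φ ⇔ ψ = (φ ⇒ ψ) ∧' (ψ ⇒ φ)

num : ℕ → Term
num zero    = zro
num (suc n) = S (num n)

∃^ : ℕ → Form → Form
∃^ zero    φ = φ
∃^ (suc n) φ = ∃' (∃^ n φ)

Subst : Set
Subst = ℕ → Term

substT : Subst → Term → Term
substT σ (var n) = σ n
substT σ zro     = zro
substT σ (S t)   = S (substT σ t)
substT σ (t ⊕ u) = substT σ t ⊕ substT σ u
substT σ (t ⊗ u) = substT σ t ⊗ substT σ u

shiftT : Term → Term
shiftT = substT (λ n → var (suc n))

_∷ₛ_ : Term → Subst → Subst
(t ∷ₛ σ) zero    = t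
(t ∷ₛ σ) (suc n) = σ n

up : Subst → Subst
up σ = var zero ∷ₛ (λ n → shiftT (σ n))

_[_] : Form → Subst → Form
⊥'       [ σ ] = ⊥'
(t == u) [ σ ] = substT σ t == substT σ u
(φ ∧' ψ) [ σ ] = (φ [ σ ]) ∧' (ψ [ σ ])
(φ ∨' ψ) [ σ ] = (φ [ σ ]) ∨' (ψ [ σ ])
(φ ⇒ ψ)  [ σ ] = (φ [ σ ]) ⇒ (ψ [ σ ])
∀' φ     [ σ ] = ∀' (φ [ up σ ])
∃' φ     [ σ ] = ∃' (φ [ up σ ])

shiftF : Form → Form
shiftF φ = φ [ (λ n → var (suc n)) ]

-- φ[t/0]: replace variable 0 by t, lower the other variables
_[_]₀ : Form → Term → Form
φ [ t ]₀ = φ [ t ∷ₛ var ]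

boundT : ℕ → Term → Set
boundT k (var n) = n < k
boundT k zro     = ⊤
boundT k (S t)   = boundT k t
boundT k (t ⊕ u) = boundT k t × boundT k u
boundT k (t ⊗ u) = boundT k t × boundT k u

boundF : ℕ → Form → Set
boundF k ⊥'       = ⊤
boundF k (t == u) = boundT k t × boundT k u
boundF k (φ ∧' ψ) = boundF k φ × boundF k ψ
boundF k (φ ∨' ψ) = boundF k φ × boundF k ψ
boundF k (φ ⇒ ψ)  = boundF k φ × boundF k ψ
boundF k (∀' φ)   = boundF (suc k) φ
boundF k (∃' φ)   = boundF (suc k) φ

closedT : Term → Set
closedT = boundT zero

infix 0 _⊢_

data _⊢_ (Γ : List Form) : Form → Set where
  ctx  : ∀ {φ} → φ ∈ Γ → Γ ⊢ φ
  ⇒I   : ∀ {φ ψ} → (φ ∷ Γ) ⊢ ψ → Γ ⊢ φ ⇒ ψ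
  ⇒E   : ∀ {φ ψ} → Γ ⊢ φ ⇒ ψ → Γ ⊢ φ → Γ ⊢ ψ
  ∀I   : ∀ {φ} → map shiftF Γ ⊢ φ → Γ ⊢ ∀' φ
  ∀E   : ∀ {φ} (t : Term) → Γ ⊢ ∀' φ → Γ ⊢ φ [ t ]₀
  ∃I   : ∀ {φ} (t : Term) → Γ ⊢ φ [ t ]₀ → Γ ⊢ ∃' φ
  ∃E   : ∀ {φ ψ} → Γ ⊢ ∃' φ → (φ ∷ map shiftF Γ) ⊢ shiftF ψ → Γ ⊢ ψ
  ⊥E   : ∀ {φ} → Γ ⊢ ⊥' → Γ ⊢ φ
  ∧I   : ∀ {φ ψ} → Γ ⊢ φ → Γ ⊢ ψ → Γ ⊢ φ ∧' ψ
  ∧E₁  : ∀ {φ ψ} → Γ ⊢ φ ∧' ψ → Γ ⊢ φ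
  ∧E₂  : ∀ {φ ψ} → Γ ⊢ φ ∧' ψ → Γ ⊢ ψ
  ∨I₁  : ∀ {φ ψ} → Γ ⊢ φ → Γ ⊢ φ ∨' ψ
  ∨I₂  : ∀ {φ ψ} → Γ ⊢ ψ → Γ ⊢ φ ∨' ψ
  ∨E   : ∀ {φ ψ θ} → Γ ⊢ φ ∨' ψ → (φ ∷ Γ) ⊢ θ → (ψ ∷ Γ) ⊢ θ → Γ ⊢ θ

private
  x0 x1 x2 x3 : Term
  x0 = var 0
  x1 = var 1
  x2 = var 2
  x3 = var 3

baseAxioms : List Form
baseAxioms =
    ∀' (S x0 == zro ⇒ ⊥')
  ∷ ∀' (∀' (S x1 == S x0 ⇒ x1 == x0))
  ∷ ∀' (zro ⊕ x0 == x0)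
  ∷ ∀' (∀' (S x1 ⊕ x0 == S (x1 ⊕ x0)))
  ∷ ∀' (zro ⊗ x0 == zro)
  ∷ ∀' (∀' (S x1 ⊗ x0 == x0 ⊕ x1 ⊗ x0))
  ∷ ∀' (x0 == x0)
  ∷ ∀' (∀' (x1 == x0 ⇒ x0 == x1))
  ∷ ∀' (∀' (∀' (x2 == x1 ⇒ x1 == x0 ⇒ x2 == x0)))
  ∷ ∀' (∀' (x1 == x0 ⇒ S x1 == S x0))
  ∷ ∀' (∀' (∀' (∀' (x3 == x2 ⇒ x1 == x0 ⇒ x3 ⊕ x1 == x2 ⊕ x0))))
  ∷ ∀' (∀' (∀' (∀' (x3 == x2 ⇒ x1 == x0 ⇒ x3 ⊗ x1 == x2 ⊗ x0))))
  ∷ []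

Qaxioms : List Form
Qaxioms = ∀' (x0 == zro ∨' ∃' (x1 == S x0)) ∷ baseAxioms

Q⊢ : Form → Set
Q⊢ φ = Qaxioms ⊢ φ

-- induction axiom for φ (variable 0 is the induction variable, the other
-- free variables are parameters; universal closure is taken semantically)
indAx : Form → Form
indAx φ = (φ [ zro ]₀ ∧' ∀' (φ ⇒ φ [ S x0 ∷ₛ (λ n → var (suc n)) ])) ⇒ ∀' φ

data HAaxiom : Form → Set where
  base : ∀ {φ} → φ ∈ baseAxioms → HAaxiom φ
  ind  : ∀ φ → HAaxiom (indAx φ)

Δ₁ : Form → Set₁
Δ₁ φ = (σ : Subst) → (∀ n → closedT (σ n)) →
       (Q⊢ (φ [ σ ])) ∨ₚ (Q⊢ (¬' (φ [ σ ])))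

Σ₁ : Form → Set₁
Σ₁ φ = Ex ℕ (λ n → Ex Form (λ φ₀ → (φ ≡ ∃^ n φ₀) × Δ₁ φ₀))

-- CT_Q: every f is represented by a binary Σ₁ formula φ_f(x,y),
-- with x = variable 0 and y = variable 1:
--   Q ⊢ ∀y. φ_f(n̄, y) ↔ \overline{f n} = y
CT-Q : Set₁
CT-Q = (f : ℕ → ℕ) →
       Ex Form (λ φ → boundF 2 φ × Σ₁ φ ×
         ((n : ℕ) → Q⊢ (∀' ((φ [ num n ]₀) ⇔ (num (f n) == var 0)))))

record Interp : Set₁ where
  field
    D    : Set
    zM   : D
    sM   : D → D
    addM : D → D → D
    mulM : D → D → D

  Env : Set
  Env = ℕ → D

  _∷ₑ_ : D → Env → Env
  (d ∷ₑ ρ) zero    = d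
  (d ∷ₑ ρ) (suc n) = ρ n

  eval : Env → Term → D
  eval ρ (var n) = ρ n
  eval ρ zro     = zM
  eval ρ (S t)   = sM (eval ρ t)
  eval ρ (t ⊕ u) = addM (eval ρ t) (eval ρ u)
  eval ρ (t ⊗ u) = mulM (eval ρ t) (eval ρ u)

  sat : Env → Form → Set₁
  sat ρ ⊥'       = Data.Empty.Polymorphic.⊥
    where import Data.Empty.Polymorphic
  sat ρ (t == u) = Level.Lift _ (eval ρ t ≡ eval ρ u)
  sat ρ (φ ∧' ψ) = sat ρ φ × sat ρ ψ
  sat ρ (φ ∨' ψ) = sat ρ φ ∨ₚ sat ρ ψ
  sat ρ (φ ⇒ ψ)  = sat ρ φ → sat ρ ψ
  sat ρ (∀' φ)   = (d : D) → sat (d ∷ₑ ρ) φ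
  sat ρ (∃' φ)   = Ex D (λ d → sat (d ∷ₑ ρ) φ)

record HAModel : Set₁ where
  field
    interp : Interp
  open Interp interp public
  field
    axioms : ∀ {φ} → HAaxiom φ → (ρ : Env) → sat ρ φ

module _ (M : HAModel) where
  open HAModel M

  numM : ℕ → D
  numM n = eval (λ _ → zM) (num n)

  std : D → Set₁
  std e = Ex ℕ (λ n → numM n ≡ e)

  nonstandard : Set₁
  nonstandard = Ex D (λ e → ¬ std e)

  divides : ℕ → D → Set₁
  divides n d = sat (λ _ → d) (∃' (num n ⊗ var 0 == var 1))

-- Let A and B be the sets of primes primeSeq n such that Q proves that the n-th formula, at n̄,
-- takes the value 0, respectively 1. They are enumerable, and disjoint because M is a model of Q;
-- by CT_Q their enumerations are represented by formulas, from which one builds θ(a): "a is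
-- enumerated into A no later than into B". In M, θ holds at the primes of A and fails at those of
-- B. For each standard n, M satisfies (up to double negation) "some c codes ¬¬θ on the primes
-- below n by divisibility", so by overspill some c codes ¬¬θ on all standard primes. If
-- divisibility of c by numerals were decidable, CT_Q would represent its characteristic function
-- on the primes; diagonalising against the representing formula puts its own prime on the wrong
-- side of θ. Provability in Q is transferred to M through the Gödel–Gentzen translation.

module Submission where

open import Level using (Lift; lift; lower) renaming (suc to lsuc; zero to lzero)
open import Data.Bool using (Bool; true; false; if_then_else_)
open import Data.Empty using (⊥; ⊥-elim)
open import Data.Nat using (ℕ; zero; suc; _+_; _*_; _≤_; _<_; _⊔_; _!; z≤n; s≤s; _≤?_)
open import Data.Nat.Properties
open import Data.Nat.Divisibility
  using (_∣_; ∣-trans; m∣m*n; n∣m*n; ∣m+n∣m⇒∣n; ∣1⇒≡1; m≤n⇒m!∣n!)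
  renaming (divides to divides-ℕ)
open import Data.Nat.Primality
  using ( Prime; prime; Composite; composite; prime?; euclidsLemma
        ; prime⇒irreducible; prime⇒nonTrivial; prime⇒nonZero )
open import Data.Nat.Primality.Factorisation using (factorise)
open import Data.Nat.ListAction using (product)
open import Data.Nat.Base using (nonTrivial⇒n>1; nonTrivial⇒≢1; ≢-nonZero⁻¹)
open import Data.Nat.Induction using (<-rec)
open import Data.List using (List; []; _∷_; map)
open import Data.List.Relation.Unary.All using (All; []; _∷_)
import Data.List.Relation.Unary.All as All
open import Data.List.Relation.Unary.Any using (here; there)
open import Data.List.Membership.Propositional using (_∈_)
open import Data.List.Membership.Propositional.Properties using (∈-map⁻)
open import Data.Maybe using (Maybe; just; nothing; fromMaybe; _>>=_)
import Data.Maybe as Maybe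
open import Data.Maybe.Properties using (just-injective) renaming (≡-dec to Maybe-≡-dec)
open import Data.Product using (Σ; ∃; _×_; _,_; proj₁; proj₂)
open import Data.Sum using (_⊎_; inj₁; inj₂; [_,_]′)
open import Relation.Binary.PropositionalEquality
  using (_≡_; _≢_; refl; sym; trans; cong; cong₂; subst; ≡-≟-identity; module ≡-Reasoning)
open import Relation.Binary.Definitions using (tri<; tri≈; tri>)
open import Relation.Nullary using (¬_; Dec; yes; no; ¬¬-excluded-middle)

open import Defs

private
  variable
    Γ : List Form
    φ ψ : Form

∥∥-map : ∀ {a b} {A : Set a} {B : Set b} → (A → B) → ∥ A ∥ → ∥ B ∥
∥∥-map f x isPropP k = x isPropP (λ a → k (f a))

∥∥-bind : ∀ {a b} {A : Set a} {B : Set b} → ∥ A ∥ → (A → ∥ B ∥) → ∥ B ∥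
∥∥-bind x f isPropP k = x isPropP (λ a → f a isPropP k)

∥∥-rec-⊥ : ∀ {a} {A : Set a} → ∥ A ∥ → (A → ⊥) → ⊥
∥∥-rec-⊥ x = x (λ ())

⊥₁ : Set₁
⊥₁ = Lift _ ⊥

-- Prime codes

prime≢0 : ∀ {p} → Prime p → p ≢ 0
prime≢0 {p} pr = ≢-nonZero⁻¹ p {{prime⇒nonZero pr}}

prime≢1 : ∀ {p} → Prime p → p ≢ 1
prime≢1 pr = nonTrivial⇒≢1 {{prime⇒nonTrivial pr}}

prime>1 : ∀ {p} → Prime p → 1 < p
prime>1 {p} pr = nonTrivial⇒n>1 p {{prime⇒nonTrivial pr}}

prime∣prime⇒≡ : ∀ {p q} → Prime p → Prime q → p ∣ q → p ≡ q
prime∣prime⇒≡ pp pq p∣q with prime⇒irreducible pq p∣q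
... | inj₁ p≡1 = ⊥-elim (prime≢1 pp p≡1)
... | inj₂ p≡q = p≡q

∣! : ∀ {p n} → 1 ≤ p → p ≤ n → p ∣ n !
∣! {suc q} _ p≤n = ∣-trans (m∣m*n (q !)) (m≤n⇒m!∣n! p≤n)

prime-above : ∀ n → Σ ℕ λ p → Prime p × n < p
prime-above n with factorise (suc (n !))
... | record { factors = [] ; isFactorisation = e } =
  ⊥-elim (≢-nonZero⁻¹ (n !) {{n !≢0}} (suc-injective e))
... | record { factors = p ∷ ps ; isFactorisation = e ; factorsPrime = pr ∷ _ } = p , pr , n<p
  where
  p∣n!+1 : p ∣ n ! + 1
  p∣n!+1 = divides-ℕ (product ps) (trans (+-comm (n !) 1) (trans e (*-comm p (product ps))))
  n<p : n < p
  n<p with p ≤? n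
  ... | no p≰n = ≰⇒> p≰n
  ... | yes p≤n = ⊥-elim (prime≢1 pr (∣1⇒≡1 (∣m+n∣m⇒∣n p∣n!+1 (∣! (<⇒≤ (prime>1 pr)) p≤n))))

primeSeq : ℕ → ℕ
primeSeq zero    = proj₁ (prime-above 0)
primeSeq (suc n) = proj₁ (prime-above (primeSeq n))

primeSeq-prime : ∀ n → Prime (primeSeq n)
primeSeq-prime zero    = proj₁ (proj₂ (prime-above 0))
primeSeq-prime (suc n) = proj₁ (proj₂ (prime-above (primeSeq n)))

primeSeq≢0 : ∀ n → primeSeq n ≢ 0
primeSeq≢0 n = prime≢0 (primeSeq-prime n)

primeSeq-strictlyIncreasing : ∀ {m n} → m < n → primeSeq m < primeSeq n
primeSeq-strictlyIncreasing {m} {suc n} m<1+n with m<1+n⇒m<n∨m≡n m<1+n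
... | inj₂ refl = proj₂ (proj₂ (prime-above (primeSeq m)))
... | inj₁ m<n  = <-trans (primeSeq-strictlyIncreasing m<n) (proj₂ (proj₂ (prime-above (primeSeq n))))

primeSeq-injective : ∀ {m n} → primeSeq m ≡ primeSeq n → m ≡ n
primeSeq-injective {m} {n} e with <-cmp m n
... | tri< m<n _ _ = ⊥-elim (<⇒≢ (primeSeq-strictlyIncreasing m<n) e)
... | tri≈ _ m≡n _ = m≡n
... | tri> _ _ n<m = ⊥-elim (<⇒≢ (primeSeq-strictlyIncreasing n<m) (sym e))

record PrimeCode (Θ : ℕ → Set₁) (n c : ℕ) : Set₁ where
  field
    nonZero : c ≢ 0
    bounded : ∀ q → Prime q → q ∣ c → q < n
    codes   : ∀ p → p < n → Prime p → (¬ ¬ Θ p → p ∣ c) × (p ∣ c → ¬ ¬ Θ p)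

¬¬-primeCode : ∀ Θ n → ¬ ¬ Σ ℕ (PrimeCode Θ n)
¬¬-primeCode Θ zero k = k (1 , record
  { nonZero = λ ()
  ; bounded = λ q pq q∣1 → ⊥-elim (prime≢1 pq (∣1⇒≡1 q∣1))
  ; codes   = λ _ () })
¬¬-primeCode Θ (suc n) k = ¬¬-primeCode Θ n λ (c , code) → extend c code
  where
  extend : ∀ c → PrimeCode Θ n c → ⊥
  extend c code with prime? n
  ... | no ¬pn = k (c , record
          { nonZero = nonZero
          ; bounded = λ q pq q∣c → m<n⇒m<1+n (bounded q pq q∣c)
          ; codes   = λ p p<1+n pp → [ (λ p<n → codes p p<n pp) , (λ { refl → ⊥-elim (¬pn pp) }) ]′
                                     (m<1+n⇒m<n∨m≡n p<1+n) })
    where open PrimeCode code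
  ... | yes pn = ¬¬-excluded-middle λ
    { (yes θn) → k (c * n , with-n θn)
    ; (no ¬θn) → k (c , without-n ¬θn) }
    where
    open PrimeCode code
    with-n : Θ n → PrimeCode Θ (suc n) (c * n)
    with-n θn = record
      { nonZero = λ cn≡0 → [ nonZero , prime≢0 pn ]′ (m*n≡0⇒m≡0∨n≡0 c cn≡0)
      ; bounded = λ q pq q∣cn → [ (λ q∣c → m<n⇒m<1+n (bounded q pq q∣c))
                                , (λ q∣n → ≤-reflexive (cong suc (prime∣prime⇒≡ pq pn q∣n))) ]′
                                (euclidsLemma c n pq q∣cn)
      ; codes   = λ p p<1+n pp → [ (λ p<n → old p p<n pp)
                                 , (λ { refl → (λ _ → n∣m*n c) , (λ _ ¬θ → ¬θ θn) }) ]′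
                                 (m<1+n⇒m<n∨m≡n p<1+n) }
      where
      old : ∀ p → p < n → Prime p → (¬ ¬ Θ p → p ∣ c * n) × (p ∣ c * n → ¬ ¬ Θ p)
      old p p<n pp = (λ ¬¬θ → ∣-trans (proj₁ (codes p p<n pp) ¬¬θ) (m∣m*n n))
                   , (λ p∣cn → [ proj₂ (codes p p<n pp)
                               , (λ p∣n → ⊥-elim (<⇒≢ p<n (prime∣prime⇒≡ pp pn p∣n))) ]′
                               (euclidsLemma c n pp p∣cn))
    without-n : ¬ Θ n → PrimeCode Θ (suc n) c
    without-n ¬θn = record
      { nonZero = nonZero
      ; bounded = λ q pq q∣c → m<n⇒m<1+n (bounded q pq q∣c)
      ; codes   = λ p p<1+n pp → [ (λ p<n → codes p p<n pp)
                                 , (λ { refl → (λ ¬¬θ → ⊥-elim (¬¬θ ¬θn))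
                                             , (λ p∣c → ⊥-elim (<-irrefl refl (bounded p pp p∣c))) }) ]′
                                 (m<1+n⇒m<n∨m≡n p<1+n) }

-- Enumerating formulas and derivations

-- unpair enumerates ℕ × ℕ diagonal by diagonal.

next : ℕ × ℕ → ℕ × ℕ
next (zero  , j) = suc j , zero
next (suc i , j) = i , suc j

unpair : ℕ → ℕ × ℕ
unpair zero    = 0 , 0
unpair (suc n) = next (unpair n)

unpair-surjective-on-diagonal : ∀ s a b → a + b ≡ s → ∃ λ m → unpair m ≡ (a , b)
unpair-surjective-on-diagonal zero    zero    zero    _  = 0 , refl
unpair-surjective-on-diagonal (suc s) a       (suc b) eq
  with unpair-surjective-on-diagonal (suc s) (suc a) b (trans (sym (+-suc a b)) eq)
... | m , e = suc m , cong next e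
unpair-surjective-on-diagonal (suc s) (suc a) zero    eq
  with unpair-surjective-on-diagonal s zero a (trans (+-comm 0 a) (suc-injective eq))
... | m , e = suc m , cong next e

unpair-surjective : ∀ a b → ∃ λ m → unpair m ≡ (a , b)
unpair-surjective a b = unpair-surjective-on-diagonal (a + b) a b refl

data Tree : Set where
  leaf : ℕ → Tree
  node : Tree → Tree → Tree

depth : Tree → ℕ
depth (leaf _)   = 0
depth (node t u) = suc (depth t ⊔ depth u)

decodeTree : ℕ → ℕ → Maybe Tree
decodeTree zero    _ = nothing
decodeTree (suc f) m with unpair m
... | zero  , n = just (leaf n)
... | suc _ , n with unpair n
...   | i , j with decodeTree f i | decodeTree f j
...     | just t | just u = just (node t u)
...     | _      | _      = nothing

decodeTree-complete : ∀ t → ∃ λ m → ∀ f → depth t < f → decodeTree f m ≡ just t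
decodeTree-complete (leaf n) with unpair-surjective 0 n
... | m , e = m , λ { (suc f) _ → decodes f {m} e }
  where
  decodes : ∀ f {m} → unpair m ≡ (0 , n) → decodeTree (suc f) m ≡ just (leaf n)
  decodes f e rewrite e = refl
decodeTree-complete (node t u) with decodeTree-complete t | decodeTree-complete u
... | i , dt | j , du with unpair-surjective i j
... | n , eij with unpair-surjective 1 n
... | m , e = m , λ { (suc f) (s≤s d<f) →
                      decodes f {m} e (dt f (<-≤-trans (s≤s (m≤m⊔n _ _)) d<f))
                                  (du f (<-≤-trans (s≤s (m≤n⊔m _ _)) d<f)) }
  where
  decodes : ∀ f {m} → unpair m ≡ (1 , n) → decodeTree f i ≡ just t → decodeTree f j ≡ just u →
            decodeTree (suc f) m ≡ just (node t u)
  decodes f e et eu rewrite e | eij | et | eu = refl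

treeAt : ℕ → Maybe Tree
treeAt m = decodeTree (proj₁ (unpair m)) (proj₂ (unpair m))

treeAt-surjective : ∀ t → ∃ λ m → treeAt m ≡ just t
treeAt-surjective t with decodeTree-complete t
... | i , dt with unpair-surjective (suc (depth t)) i
... | m , e = m , decodes {m} e
  where
  decodes : ∀ {m} → unpair m ≡ (suc (depth t) , i) → treeAt m ≡ just t
  decodes e rewrite e = dt (suc (depth t)) ≤-refl

_≟ᵀ_ : (t u : Tree) → Dec (t ≡ u)
leaf n ≟ᵀ leaf m with n ≟ m
... | yes refl = yes refl
... | no n≢m   = no λ { refl → n≢m refl }
leaf _ ≟ᵀ node _ _ = no λ ()
node _ _ ≟ᵀ leaf _ = no λ ()
node t u ≟ᵀ node t′ u′ with t ≟ᵀ t′ | u ≟ᵀ u′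
... | yes refl | yes refl = yes refl
... | no t≢t′  | _        = no λ { refl → t≢t′ refl }
... | _        | no u≢u′  = no λ { refl → u≢u′ refl }

record Encodable (X : Set) : Set where
  field
    encode         : X → Tree
    parse          : Tree → Maybe X
    parse-encode   : ∀ x → parse (encode x) ≡ just x

  encode-injective : ∀ {x y} → encode x ≡ encode y → x ≡ y
  encode-injective {x} {y} e =
    just-injective (trans (sym (parse-encode x)) (trans (cong parse e) (parse-encode y)))

  ≡-dec : (x y : X) → Dec (x ≡ y)
  ≡-dec x y with encode x ≟ᵀ encode y
  ... | yes e   = yes (encode-injective e)
  ... | no x≢y = no λ e → x≢y (cong encode e)

  enumerate : X → ℕ → X
  enumerate default m = fromMaybe default (treeAt m >>= parse)

  enumerate-surjective : ∀ default x → ∃ λ m → enumerate default m ≡ x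
  enumerate-surjective default x with treeAt-surjective (encode x)
  ... | m , e = m , hits
    where
    hits : enumerate default m ≡ x
    hits rewrite e | parse-encode x = refl

encodeTerm : Term → Tree
encodeTerm (var n) = node (leaf 0) (leaf n)
encodeTerm zro     = node (leaf 1) (leaf 0)
encodeTerm (S t)   = node (leaf 2) (encodeTerm t)
encodeTerm (t ⊕ u) = node (leaf 3) (node (encodeTerm t) (encodeTerm u))
encodeTerm (t ⊗ u) = node (leaf 4) (node (encodeTerm t) (encodeTerm u))

parseTerm : Tree → Maybe Term
parseTerm (node (leaf 0) (leaf n))   = just (var n)
parseTerm (node (leaf 1) _)          = just zro
parseTerm (node (leaf 2) a)          = Maybe.map S (parseTerm a)
parseTerm (node (leaf 3) (node a b)) = parseTerm a >>= λ t → Maybe.map (t ⊕_) (parseTerm b)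
parseTerm (node (leaf 4) (node a b)) = parseTerm a >>= λ t → Maybe.map (t ⊗_) (parseTerm b)
parseTerm _                          = nothing

parseTerm-encodeTerm : ∀ t → parseTerm (encodeTerm t) ≡ just t
parseTerm-encodeTerm (var n) = refl
parseTerm-encodeTerm zro     = refl
parseTerm-encodeTerm (S t)   rewrite parseTerm-encodeTerm t = refl
parseTerm-encodeTerm (t ⊕ u) rewrite parseTerm-encodeTerm t | parseTerm-encodeTerm u = refl
parseTerm-encodeTerm (t ⊗ u) rewrite parseTerm-encodeTerm t | parseTerm-encodeTerm u = refl

encodeForm : Form → Tree
encodeForm ⊥'       = node (leaf 0) (leaf 0)
encodeForm (t == u) = node (leaf 1) (node (encodeTerm t) (encodeTerm u))
encodeForm (φ ∧' ψ) = node (leaf 2) (node (encodeForm φ) (encodeForm ψ))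
encodeForm (φ ∨' ψ) = node (leaf 3) (node (encodeForm φ) (encodeForm ψ))
encodeForm (φ ⇒ ψ)  = node (leaf 4) (node (encodeForm φ) (encodeForm ψ))
encodeForm (∀' φ)   = node (leaf 5) (encodeForm φ)
encodeForm (∃' φ)   = node (leaf 6) (encodeForm φ)

parseForm : Tree → Maybe Form
parseForm (node (leaf 0) _)          = just ⊥'
parseForm (node (leaf 1) (node a b)) = parseTerm a >>= λ t → Maybe.map (t ==_) (parseTerm b)
parseForm (node (leaf 2) (node a b)) = parseForm a >>= λ φ → Maybe.map (φ ∧'_) (parseForm b)
parseForm (node (leaf 3) (node a b)) = parseForm a >>= λ φ → Maybe.map (φ ∨'_) (parseForm b)
parseForm (node (leaf 4) (node a b)) = parseForm a >>= λ φ → Maybe.map (φ ⇒_) (parseForm b)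
parseForm (node (leaf 5) a)          = Maybe.map ∀' (parseForm a)
parseForm (node (leaf 6) a)          = Maybe.map ∃' (parseForm a)
parseForm _                          = nothing

parseForm-encodeForm : ∀ φ → parseForm (encodeForm φ) ≡ just φ
parseForm-encodeForm ⊥'       = refl
parseForm-encodeForm (t == u) rewrite parseTerm-encodeTerm t | parseTerm-encodeTerm u = refl
parseForm-encodeForm (φ ∧' ψ) rewrite parseForm-encodeForm φ | parseForm-encodeForm ψ = refl
parseForm-encodeForm (φ ∨' ψ) rewrite parseForm-encodeForm φ | parseForm-encodeForm ψ = refl
parseForm-encodeForm (φ ⇒ ψ)  rewrite parseForm-encodeForm φ | parseForm-encodeForm ψ = refl
parseForm-encodeForm (∀' φ)   rewrite parseForm-encodeForm φ = refl
parseForm-encodeForm (∃' φ)   rewrite parseForm-encodeForm φ = refl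

encodableForm : Encodable Form
encodableForm = record { encode = encodeForm ; parse = parseForm ; parse-encode = parseForm-encodeForm }

_≟ᶠ_ : (φ ψ : Form) → Dec (φ ≡ ψ)
_≟ᶠ_ = Encodable.≡-dec encodableForm

open import Data.List.Membership.DecPropositional _≟ᶠ_ using (_∈?_)

formAt : ℕ → Form
formAt = Encodable.enumerate encodableForm ⊥'

formAt-surjective : ∀ φ → ∃ λ n → formAt n ≡ φ
formAt-surjective = Encodable.enumerate-surjective encodableForm ⊥'

-- Raw derivations carry just enough annotation for their conclusion to be inferred.

data Raw : Set where
  r-ctx : Form → Raw
  r⇒I   : Form → Raw → Raw
  r⇒E   : Raw → Raw → Raw
  r∀I   : Raw → Raw
  r∀E   : Term → Raw → Raw
  r∃I   : Form → Term → Raw → Raw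
  r∃E   : Form → Raw → Raw → Raw
  r⊥E   : Form → Raw → Raw
  r∧I   : Raw → Raw → Raw
  r∧E₁  : Raw → Raw
  r∧E₂  : Raw → Raw
  r∨I₁  : Form → Raw → Raw
  r∨I₂  : Form → Raw → Raw
  r∨E   : Raw → Raw → Raw → Raw

encodeRaw : Raw → Tree
encodeRaw (r-ctx φ)   = node (leaf 0) (encodeForm φ)
encodeRaw (r⇒I φ r)   = node (leaf 1) (node (encodeForm φ) (encodeRaw r))
encodeRaw (r⇒E r s)   = node (leaf 2) (node (encodeRaw r) (encodeRaw s))
encodeRaw (r∀I r)     = node (leaf 3) (encodeRaw r)
encodeRaw (r∀E t r)   = node (leaf 4) (node (encodeTerm t) (encodeRaw r))
encodeRaw (r∃I φ t r) = node (leaf 5) (node (encodeForm φ) (node (encodeTerm t) (encodeRaw r)))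
encodeRaw (r∃E φ r s) = node (leaf 6) (node (encodeForm φ) (node (encodeRaw r) (encodeRaw s)))
encodeRaw (r⊥E φ r)   = node (leaf 7) (node (encodeForm φ) (encodeRaw r))
encodeRaw (r∧I r s)   = node (leaf 8) (node (encodeRaw r) (encodeRaw s))
encodeRaw (r∧E₁ r)    = node (leaf 9) (encodeRaw r)
encodeRaw (r∧E₂ r)    = node (leaf 10) (encodeRaw r)
encodeRaw (r∨I₁ φ r)  = node (leaf 11) (node (encodeForm φ) (encodeRaw r))
encodeRaw (r∨I₂ φ r)  = node (leaf 12) (node (encodeForm φ) (encodeRaw r))
encodeRaw (r∨E r s u) = node (leaf 13) (node (encodeRaw r) (node (encodeRaw s) (encodeRaw u)))

parseRaw : Tree → Maybe Raw
parseRaw (node (leaf 0) a) = Maybe.map r-ctx (parseForm a)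
parseRaw (node (leaf 1) (node a b)) =
  parseForm a >>= λ φ → Maybe.map (r⇒I φ) (parseRaw b)
parseRaw (node (leaf 2) (node a b)) =
  parseRaw a >>= λ r → Maybe.map (r⇒E r) (parseRaw b)
parseRaw (node (leaf 3) a) = Maybe.map r∀I (parseRaw a)
parseRaw (node (leaf 4) (node a b)) =
  parseTerm a >>= λ t → Maybe.map (r∀E t) (parseRaw b)
parseRaw (node (leaf 5) (node a (node b c))) =
  parseForm a >>= λ φ → parseTerm b >>= λ t → Maybe.map (r∃I φ t) (parseRaw c)
parseRaw (node (leaf 6) (node a (node b c))) =
  parseForm a >>= λ φ → parseRaw b >>= λ r → Maybe.map (r∃E φ r) (parseRaw c)
parseRaw (node (leaf 7) (node a b)) =
  parseForm a >>= λ φ → Maybe.map (r⊥E φ) (parseRaw b)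
parseRaw (node (leaf 8) (node a b)) =
  parseRaw a >>= λ r → Maybe.map (r∧I r) (parseRaw b)
parseRaw (node (leaf 9) a)  = Maybe.map r∧E₁ (parseRaw a)
parseRaw (node (leaf 10) a) = Maybe.map r∧E₂ (parseRaw a)
parseRaw (node (leaf 11) (node a b)) =
  parseForm a >>= λ φ → Maybe.map (r∨I₁ φ) (parseRaw b)
parseRaw (node (leaf 12) (node a b)) =
  parseForm a >>= λ φ → Maybe.map (r∨I₂ φ) (parseRaw b)
parseRaw (node (leaf 13) (node a (node b c))) =
  parseRaw a >>= λ r → parseRaw b >>= λ s → Maybe.map (r∨E r s) (parseRaw c)
parseRaw _ = nothing

parseRaw-encodeRaw : ∀ r → parseRaw (encodeRaw r) ≡ just r
parseRaw-encodeRaw (r-ctx φ)   rewrite parseForm-encodeForm φ = refl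
parseRaw-encodeRaw (r⇒I φ r)   rewrite parseForm-encodeForm φ | parseRaw-encodeRaw r = refl
parseRaw-encodeRaw (r⇒E r s)   rewrite parseRaw-encodeRaw r | parseRaw-encodeRaw s = refl
parseRaw-encodeRaw (r∀I r)     rewrite parseRaw-encodeRaw r = refl
parseRaw-encodeRaw (r∀E t r)   rewrite parseTerm-encodeTerm t | parseRaw-encodeRaw r = refl
parseRaw-encodeRaw (r∃I φ t r)
  rewrite parseForm-encodeForm φ | parseTerm-encodeTerm t | parseRaw-encodeRaw r = refl
parseRaw-encodeRaw (r∃E φ r s)
  rewrite parseForm-encodeForm φ | parseRaw-encodeRaw r | parseRaw-encodeRaw s = refl
parseRaw-encodeRaw (r⊥E φ r)   rewrite parseForm-encodeForm φ | parseRaw-encodeRaw r = refl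
parseRaw-encodeRaw (r∧I r s)   rewrite parseRaw-encodeRaw r | parseRaw-encodeRaw s = refl
parseRaw-encodeRaw (r∧E₁ r)    rewrite parseRaw-encodeRaw r = refl
parseRaw-encodeRaw (r∧E₂ r)    rewrite parseRaw-encodeRaw r = refl
parseRaw-encodeRaw (r∨I₁ φ r)  rewrite parseForm-encodeForm φ | parseRaw-encodeRaw r = refl
parseRaw-encodeRaw (r∨I₂ φ r)  rewrite parseForm-encodeForm φ | parseRaw-encodeRaw r = refl
parseRaw-encodeRaw (r∨E r s u)
  rewrite parseRaw-encodeRaw r | parseRaw-encodeRaw s | parseRaw-encodeRaw u = refl

encodableRaw : Encodable Raw
encodableRaw = record { encode = encodeRaw ; parse = parseRaw ; parse-encode = parseRaw-encodeRaw }

rawAt : ℕ → Raw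
rawAt = Encodable.enumerate encodableRaw (r-ctx ⊥')

rawAt-surjective : ∀ r → ∃ λ m → rawAt m ≡ r
rawAt-surjective = Encodable.enumerate-surjective encodableRaw (r-ctx ⊥')

Derivation : List Form → Set
Derivation Γ = Σ Form (Γ ⊢_)

conclusion : Maybe (Derivation Γ) → Maybe Form
conclusion = Maybe.map proj₁

⇒E? : Derivation Γ → Derivation Γ → Maybe (Derivation Γ)
⇒E? ((φ ⇒ ψ) , d) (φ′ , e) with φ ≟ᶠ φ′
... | yes refl = just (ψ , ⇒E d e)
... | no _     = nothing
⇒E? _ _ = nothing

∀E? : Term → Derivation Γ → Maybe (Derivation Γ)
∀E? t (∀' φ , d) = just (φ [ t ]₀ , ∀E t d)
∀E? _ _          = nothing

∃I? : Form → Term → Derivation Γ → Maybe (Derivation Γ)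
∃I? φ t (φ′ , d) with φ′ ≟ᶠ (φ [ t ]₀)
... | yes refl = just (∃' φ , ∃I t d)
... | no _     = nothing

∃E? : Form → Γ ⊢ ∃' φ → Derivation (φ ∷ map shiftF Γ) → Maybe (Derivation Γ)
∃E? ψ d (χ , e) with χ ≟ᶠ shiftF ψ
... | yes refl = just (ψ , ∃E d e)
... | no _     = nothing

⊥E? : Form → Derivation Γ → Maybe (Derivation Γ)
⊥E? φ (⊥' , d) = just (φ , ⊥E d)
⊥E? _ _        = nothing

∧E₁? : Derivation Γ → Maybe (Derivation Γ)
∧E₁? ((φ ∧' ψ) , d) = just (φ , ∧E₁ d)
∧E₁? _              = nothing

∧E₂? : Derivation Γ → Maybe (Derivation Γ)
∧E₂? ((φ ∧' ψ) , d) = just (ψ , ∧E₂ d)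
∧E₂? _              = nothing

∨E? : Γ ⊢ φ ∨' ψ → Derivation (φ ∷ Γ) → Derivation (ψ ∷ Γ) → Maybe (Derivation Γ)
∨E? d (θ , e) (θ′ , f) with θ ≟ᶠ θ′
... | yes refl = just (θ , ∨E d e f)
... | no _     = nothing

infer : (Γ : List Form) → Raw → Maybe (Derivation Γ)
infer∃E : Form → Raw → Derivation Γ → Maybe (Derivation Γ)
infer∨E : Raw → Raw → Derivation Γ → Maybe (Derivation Γ)

infer Γ (r-ctx φ) with φ ∈? Γ
... | yes φ∈Γ = just (φ , ctx φ∈Γ)
... | no _    = nothing
infer Γ (r⇒I φ r)   = infer (φ ∷ Γ) r >>= λ (ψ , d) → just ((φ ⇒ ψ) , ⇒I d)
infer Γ (r⇒E r s)   = infer Γ r >>= λ d → infer Γ s >>= ⇒E? d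
infer Γ (r∀I r)     = infer (map shiftF Γ) r >>= λ (φ , d) → just (∀' φ , ∀I d)
infer Γ (r∀E t r)   = infer Γ r >>= ∀E? t
infer Γ (r∃I φ t r) = infer Γ r >>= ∃I? φ t
infer Γ (r∃E ψ r s) = infer Γ r >>= infer∃E ψ s
infer Γ (r⊥E φ r)   = infer Γ r >>= ⊥E? φ
infer Γ (r∧I r s)   = infer Γ r >>= λ (φ , d) → infer Γ s >>= λ (ψ , e) → just ((φ ∧' ψ) , ∧I d e)
infer Γ (r∧E₁ r)    = infer Γ r >>= ∧E₁?
infer Γ (r∧E₂ r)    = infer Γ r >>= ∧E₂?
infer Γ (r∨I₁ ψ r)  = infer Γ r >>= λ (φ , d) → just ((φ ∨' ψ) , ∨I₁ d)
infer Γ (r∨I₂ φ r)  = infer Γ r >>= λ (ψ , d) → just ((φ ∨' ψ) , ∨I₂ d)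
infer Γ (r∨E r s u) = infer Γ r >>= infer∨E s u

infer∃E {Γ} ψ s (∃' φ , d) = infer (φ ∷ map shiftF Γ) s >>= ∃E? ψ d
infer∃E _ _ _              = nothing

infer∨E {Γ} s u ((φ ∨' ψ) , d) = infer (φ ∷ Γ) s >>= λ e → infer (ψ ∷ Γ) u >>= ∨E? d e
infer∨E _ _ _                = nothing

erase : Γ ⊢ φ → Raw
erase {φ = φ} (ctx _)      = r-ctx φ
erase (⇒I {φ} d)           = r⇒I φ (erase d)
erase (⇒E d e)             = r⇒E (erase d) (erase e)
erase (∀I d)               = r∀I (erase d)
erase (∀E t d)             = r∀E t (erase d)
erase (∃I {φ} t d)         = r∃I φ t (erase d)
erase (∃E {ψ = ψ} d e)     = r∃E ψ (erase d) (erase e)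
erase {φ = φ} (⊥E d)       = r⊥E φ (erase d)
erase (∧I d e)             = r∧I (erase d) (erase e)
erase (∧E₁ d)              = r∧E₁ (erase d)
erase (∧E₂ d)              = r∧E₂ (erase d)
erase (∨I₁ {ψ = ψ} d)      = r∨I₁ ψ (erase d)
erase (∨I₂ {φ} d)          = r∨I₂ φ (erase d)
erase (∨E d e f)           = r∨E (erase d) (erase e) (erase f)

Infers : (Γ : List Form) → Raw → Form → Set
Infers Γ r φ = Σ (Γ ⊢ φ) λ d → infer Γ r ≡ just (φ , d)

≟ᶠ-refl : ∀ φ → (φ ≟ᶠ φ) ≡ yes refl
≟ᶠ-refl φ = ≡-≟-identity _≟ᶠ_ refl

infer-complete : (d : Γ ⊢ φ) → Infers Γ (erase d) φ
infer-complete {Γ} {φ} (ctx φ∈Γ) with φ ∈? Γ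
... | yes φ∈Γ′ = ctx φ∈Γ′ , refl
... | no φ∉Γ   = ⊥-elim (φ∉Γ φ∈Γ)
infer-complete (⇒I d) with infer-complete d
... | d′ , eq rewrite eq = ⇒I d′ , refl
infer-complete (⇒E {φ} d e) with infer-complete d | infer-complete e
... | d′ , eq₁ | e′ , eq₂ rewrite eq₁ | eq₂ | ≟ᶠ-refl φ = ⇒E d′ e′ , refl
infer-complete (∀I d) with infer-complete d
... | d′ , eq rewrite eq = ∀I d′ , refl
infer-complete (∀E t d) with infer-complete d
... | d′ , eq rewrite eq = ∀E t d′ , refl
infer-complete (∃I {φ} t d) with infer-complete d
... | d′ , eq rewrite eq | ≟ᶠ-refl (φ [ t ]₀) = ∃I t d′ , refl
infer-complete (∃E {ψ = ψ} d e) with infer-complete d | infer-complete e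
... | d′ , eq₁ | e′ , eq₂ rewrite eq₁ | eq₂ | ≟ᶠ-refl (shiftF ψ) = ∃E d′ e′ , refl
infer-complete (⊥E d) with infer-complete d
... | d′ , eq rewrite eq = ⊥E d′ , refl
infer-complete (∧I d e) with infer-complete d | infer-complete e
... | d′ , eq₁ | e′ , eq₂ rewrite eq₁ | eq₂ = ∧I d′ e′ , refl
infer-complete (∧E₁ d) with infer-complete d
... | d′ , eq rewrite eq = ∧E₁ d′ , refl
infer-complete (∧E₂ d) with infer-complete d
... | d′ , eq rewrite eq = ∧E₂ d′ , refl
infer-complete (∨I₁ d) with infer-complete d
... | d′ , eq rewrite eq = ∨I₁ d′ , refl
infer-complete (∨I₂ d) with infer-complete d
... | d′ , eq rewrite eq = ∨I₂ d′ , refl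
infer-complete (∨E {θ = θ} d e f) with infer-complete d | infer-complete e | infer-complete f
... | d′ , eq₁ | e′ , eq₂ | f′ , eq₃ rewrite eq₁ | eq₂ | eq₃ | ≟ᶠ-refl θ = ∨E d′ e′ f′ , refl

theoremAt : List Form → ℕ → Maybe Form
theoremAt Γ m = conclusion (infer Γ (rawAt m))

theoremAt-sound : ∀ m → theoremAt Γ m ≡ just φ → Γ ⊢ φ
theoremAt-sound {Γ} m eq with infer Γ (rawAt m)
theoremAt-sound m refl | just (_ , d) = d

theoremAt-complete : Γ ⊢ φ → ∃ λ m → theoremAt Γ m ≡ just φ
theoremAt-complete {Γ} d with rawAt-surjective (erase d)
... | m , eq = m , cong conclusion (trans (cong (infer Γ) eq) (proj₂ (infer-complete d)))

Computes : Form → ℕ → ℕ → Form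
Computes φ n b = ∀' ((φ [ num n ]₀) ⇔ (num b == var 0))

Represents : (ℕ → ℕ) → Form → Set
Represents f φ = ∀ n → Q⊢ (Computes φ n (f n))

diagonalClaim : ℕ → ℕ → Form
diagonalClaim n b = Computes (formAt n) n b

listingAt : ℕ → ℕ × ℕ → ℕ
listingAt b (k , n) with Maybe-≡-dec _≟ᶠ_ (theoremAt Qaxioms k) (just (diagonalClaim n b))
... | yes _ = primeSeq n
... | no _  = 0

-- 0 is a junk value: listing b m is primeSeq n when the theorem coded by m is diagonalClaim n b.
listing : ℕ → ℕ → ℕ
listing b m = listingAt b (unpair m)

listing-sound : ∀ b m {p} → listing b m ≡ p → p ≢ 0 →
                Σ ℕ λ n → primeSeq n ≡ p × Q⊢ (diagonalClaim n b)
listing-sound b m = sound (unpair m)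
  where
  sound : ∀ kn {p} → listingAt b kn ≡ p → p ≢ 0 → Σ ℕ λ n → primeSeq n ≡ p × Q⊢ (diagonalClaim n b)
  sound (k , n) eq p≢0 with Maybe-≡-dec _≟ᶠ_ (theoremAt Qaxioms k) (just (diagonalClaim n b))
  ... | yes proved = n , eq , theoremAt-sound k proved
  ... | no _       = ⊥-elim (p≢0 (sym eq))

listing-complete : ∀ b n → Q⊢ (diagonalClaim n b) → Σ ℕ λ m → listing b m ≡ primeSeq n
listing-complete b n d with theoremAt-complete d
... | k , proved with unpair-surjective k n
... | m , eq = m , hits
  where
  hits : listing b m ≡ primeSeq n
  hits rewrite eq | ≡-≟-identity (Maybe-≡-dec _≟ᶠ_) proved = refl

-- Gödel–Gentzen negative translation

_ᴳ : Form → Form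
⊥' ᴳ       = ⊥'
(t == u) ᴳ = ¬' (¬' (t == u))
(φ ∧' ψ) ᴳ = φ ᴳ ∧' ψ ᴳ
(φ ∨' ψ) ᴳ = ¬' (¬' (φ ᴳ) ∧' ¬' (ψ ᴳ))
(φ ⇒ ψ) ᴳ  = φ ᴳ ⇒ ψ ᴳ
∀' φ ᴳ     = ∀' (φ ᴳ)
∃' φ ᴳ     = ¬' (∀' (¬' (φ ᴳ)))

ᴳ-subst : ∀ φ σ → (φ [ σ ]) ᴳ ≡ (φ ᴳ) [ σ ]
ᴳ-subst ⊥'       σ = refl
ᴳ-subst (t == u) σ = refl
ᴳ-subst (φ ∧' ψ) σ = cong₂ _∧'_ (ᴳ-subst φ σ) (ᴳ-subst ψ σ)
ᴳ-subst (φ ∨' ψ) σ rewrite ᴳ-subst φ σ | ᴳ-subst ψ σ = refl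
ᴳ-subst (φ ⇒ ψ)  σ = cong₂ _⇒_ (ᴳ-subst φ σ) (ᴳ-subst ψ σ)
ᴳ-subst (∀' φ)   σ = cong ∀' (ᴳ-subst φ (up σ))
ᴳ-subst (∃' φ)   σ rewrite ᴳ-subst φ (up σ) = refl

module Semantics (I : Interp) where
  open Interp I

  Agrees : Env → Subst → Env → Set
  Agrees ρ σ ρ′ = ∀ n → eval ρ (σ n) ≡ ρ′ n

  eval-subst : ∀ {ρ σ ρ′} → Agrees ρ σ ρ′ → ∀ t → eval ρ (substT σ t) ≡ eval ρ′ t
  eval-subst h (var n) = h n
  eval-subst h zro     = refl
  eval-subst h (S t)   = cong sM (eval-subst h t)
  eval-subst h (t ⊕ u) = cong₂ addM (eval-subst h t) (eval-subst h u)
  eval-subst h (t ⊗ u) = cong₂ mulM (eval-subst h t) (eval-subst h u)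

  Agrees-up : ∀ {ρ σ ρ′} → Agrees ρ σ ρ′ → ∀ d → Agrees (d ∷ₑ ρ) (up σ) (d ∷ₑ ρ′)
  Agrees-up h d zero    = refl
  Agrees-up {σ = σ} h d (suc n) = trans (eval-subst (λ _ → refl) (σ n)) (h n)

  sat-subst : ∀ φ {ρ σ ρ′} → Agrees ρ σ ρ′ → sat ρ (φ [ σ ]) ↔ sat ρ′ φ
  sat-subst ⊥' h = (λ x → x) , (λ x → x)
  sat-subst (t == u) h =
      (λ (lift e) → lift (trans (sym (eval-subst h t)) (trans e (eval-subst h u))))
    , (λ (lift e) → lift (trans (eval-subst h t) (trans e (sym (eval-subst h u)))))
  sat-subst (φ ∧' ψ) h =
      (λ (a , b) → proj₁ (sat-subst φ h) a , proj₁ (sat-subst ψ h) b)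
    , (λ (a , b) → proj₂ (sat-subst φ h) a , proj₂ (sat-subst ψ h) b)
  sat-subst (φ ∨' ψ) h =
      ∥∥-map (Data.Sum.map (proj₁ (sat-subst φ h)) (proj₁ (sat-subst ψ h)))
    , ∥∥-map (Data.Sum.map (proj₂ (sat-subst φ h)) (proj₂ (sat-subst ψ h)))
  sat-subst (φ ⇒ ψ) h =
      (λ f x → proj₁ (sat-subst ψ h) (f (proj₂ (sat-subst φ h) x)))
    , (λ f x → proj₂ (sat-subst ψ h) (f (proj₁ (sat-subst φ h) x)))
  sat-subst (∀' φ) {σ = σ} h =
      (λ f d → proj₁ (sat-subst φ (Agrees-up {σ = σ} h d)) (f d))
    , (λ f d → proj₂ (sat-subst φ (Agrees-up {σ = σ} h d)) (f d))
  sat-subst (∃' φ) {σ = σ} h =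
      ∥∥-map (λ (d , x) → d , proj₁ (sat-subst φ (Agrees-up {σ = σ} h d)) x)
    , ∥∥-map (λ (d , x) → d , proj₂ (sat-subst φ (Agrees-up {σ = σ} h d)) x)

  sat-inst : ∀ φ {ρ} t → sat ρ (φ [ t ]₀) ↔ sat (eval ρ t ∷ₑ ρ) φ
  sat-inst φ t = sat-subst φ λ { zero → refl ; (suc n) → refl }

  satᴳ-subst : ∀ φ {ρ σ ρ′} → Agrees ρ σ ρ′ → sat ρ ((φ [ σ ]) ᴳ) ↔ sat ρ′ (φ ᴳ)
  satᴳ-subst φ {σ = σ} h rewrite ᴳ-subst φ σ = sat-subst (φ ᴳ) h

  satᴳ-shift : ∀ φ {ρ} d → sat (d ∷ₑ ρ) (shiftF φ ᴳ) ↔ sat ρ (φ ᴳ)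
  satᴳ-shift φ d = satᴳ-subst φ (λ _ → refl)

  satᴳ-inst : ∀ φ {ρ} t → sat ρ ((φ [ t ]₀) ᴳ) ↔ sat (eval ρ t ∷ₑ ρ) (φ ᴳ)
  satᴳ-inst φ t = satᴳ-subst φ λ { zero → refl ; (suc n) → refl }

  satᴳ-stable : ∀ φ ρ → ((sat ρ (φ ᴳ) → ⊥₁) → ⊥₁) → sat ρ (φ ᴳ)
  satᴳ-stable ⊥'       ρ ¬¬s = ¬¬s (λ x → x)
  satᴳ-stable (t == u) ρ ¬¬s = λ k → ¬¬s (λ f → f k)
  satᴳ-stable (φ ∧' ψ) ρ ¬¬s = satᴳ-stable φ ρ (λ k → ¬¬s (λ (a , _) → k a))
                             , satᴳ-stable ψ ρ (λ k → ¬¬s (λ (_ , b) → k b))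
  satᴳ-stable (φ ∨' ψ) ρ ¬¬s = λ p → ¬¬s (λ f → f p)
  satᴳ-stable (φ ⇒ ψ)  ρ ¬¬s = λ x → satᴳ-stable ψ ρ (λ k → ¬¬s (λ f → k (f x)))
  satᴳ-stable (∀' φ)   ρ ¬¬s = λ d → satᴳ-stable φ (d ∷ₑ ρ) (λ k → ¬¬s (λ f → k (f d)))
  satᴳ-stable (∃' φ)   ρ ¬¬s = λ p → ¬¬s (λ f → f p)

  satᴳ-shiftCtx : ∀ {ρ} → (∀ {ψ} → ψ ∈ Γ → sat ρ (ψ ᴳ)) → ∀ x {ψ} → ψ ∈ map shiftF Γ → sat (x ∷ₑ ρ) (ψ ᴳ)
  satᴳ-shiftCtx {Γ} h x m with ∈-map⁻ shiftF m
  ... | ψ , m′ , refl = proj₂ (satᴳ-shift ψ x) (h m′)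

  -- ∃ and ∨ are interpreted by a truncation that eliminates only into propositions of Set, so
  -- plain soundness fails for ∃E and ∨E; the translated conclusion is ¬¬-stable instead.
  ᴳ-sound : Γ ⊢ φ → ∀ ρ → (∀ {ψ} → ψ ∈ Γ → sat ρ (ψ ᴳ)) → sat ρ (φ ᴳ)
  ᴳ-sound (ctx φ∈Γ) ρ h = h φ∈Γ
  ᴳ-sound (⇒I d)    ρ h = λ x → ᴳ-sound d ρ λ { (here refl) → x ; (there m) → h m }
  ᴳ-sound (⇒E d e)  ρ h = ᴳ-sound d ρ h (ᴳ-sound e ρ h)
  ᴳ-sound (∀I d)    ρ h = λ x → ᴳ-sound d (x ∷ₑ ρ) (satᴳ-shiftCtx h x)
  ᴳ-sound (∀E {φ} t d) ρ h = proj₂ (satᴳ-inst φ t) (ᴳ-sound d ρ h (eval ρ t))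
  ᴳ-sound (∃I {φ} t d) ρ h = λ f → f (eval ρ t) (proj₁ (satᴳ-inst φ t) (ᴳ-sound d ρ h))
  ᴳ-sound (∃E {φ} {ψ} d e) ρ h = satᴳ-stable ψ ρ λ k → ᴳ-sound d ρ h λ x sx →
    k (proj₁ (satᴳ-shift ψ x)
             (ᴳ-sound e (x ∷ₑ ρ) λ { (here refl) → sx ; (there m) → satᴳ-shiftCtx h x m }))
  ᴳ-sound (⊥E d)    ρ h with ᴳ-sound d ρ h
  ... | ()
  ᴳ-sound (∧I d e)  ρ h = ᴳ-sound d ρ h , ᴳ-sound e ρ h
  ᴳ-sound (∧E₁ d)   ρ h = proj₁ (ᴳ-sound d ρ h)
  ᴳ-sound (∧E₂ d)   ρ h = proj₂ (ᴳ-sound d ρ h)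
  ᴳ-sound (∨I₁ d)   ρ h = λ (¬a , _) → ¬a (ᴳ-sound d ρ h)
  ᴳ-sound (∨I₂ d)   ρ h = λ (_ , ¬b) → ¬b (ᴳ-sound d ρ h)
  ᴳ-sound (∨E {θ = θ} d e f) ρ h = satᴳ-stable θ ρ λ k → ᴳ-sound d ρ h
    ( (λ a → k (ᴳ-sound e ρ λ { (here refl) → a ; (there m) → h m }))
    , (λ b → k (ᴳ-sound f ρ λ { (here refl) → b ; (there m) → h m })) )

data UniversalHorn : Form → Set where
  ⊥-horn  : UniversalHorn ⊥'
  ==-horn : ∀ {t u} → UniversalHorn (t == u)
  ⇒-horn  : ∀ {t u} → UniversalHorn φ → UniversalHorn ((t == u) ⇒ φ)
  ∀-horn  : UniversalHorn φ → UniversalHorn (∀' φ)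

baseAxioms-horn : All UniversalHorn baseAxioms
baseAxioms-horn =
    ∀-horn (⇒-horn ⊥-horn)
  ∷ ∀-horn (∀-horn (⇒-horn ==-horn))
  ∷ ∀-horn ==-horn
  ∷ ∀-horn (∀-horn ==-horn)
  ∷ ∀-horn ==-horn
  ∷ ∀-horn (∀-horn ==-horn)
  ∷ ∀-horn ==-horn
  ∷ ∀-horn (∀-horn (⇒-horn ==-horn))
  ∷ ∀-horn (∀-horn (∀-horn (⇒-horn (⇒-horn ==-horn))))
  ∷ ∀-horn (∀-horn (⇒-horn ==-horn))
  ∷ ∀-horn (∀-horn (∀-horn (∀-horn (⇒-horn (⇒-horn ==-horn)))))
  ∷ ∀-horn (∀-horn (∀-horn (∀-horn (⇒-horn (⇒-horn ==-horn)))))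
  ∷ []

module Model (M : HAModel) where
  open HAModel M public
  open Semantics interp public

  ρ₀ : Env
  ρ₀ _ = zM

  sat-horn⇒satᴳ : UniversalHorn φ → ∀ ρ → sat ρ φ → sat ρ (φ ᴳ)
  sat-horn⇒satᴳ ⊥-horn      ρ s = s
  sat-horn⇒satᴳ ==-horn     ρ s = λ k → k s
  sat-horn⇒satᴳ (⇒-horn {φ = φ} h) ρ f =
    λ ¬¬e → satᴳ-stable φ ρ λ k → ¬¬e λ e → k (sat-horn⇒satᴳ h ρ (f e))
  sat-horn⇒satᴳ (∀-horn h)  ρ f = λ d → sat-horn⇒satᴳ h (d ∷ₑ ρ) (f d)

  sM≢zM : ∀ a → sM a ≢ zM
  sM≢zM a e = lower (axioms (base (here refl)) ρ₀ a (lift e))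

  sM-injective : ∀ {a b} → sM a ≡ sM b → a ≡ b
  sM-injective {a} {b} e = lower (axioms (base (there (here refl))) ρ₀ a b (lift e))

  addM-identityˡ : ∀ a → addM zM a ≡ a
  addM-identityˡ a = lower (axioms (base (there (there (here refl)))) ρ₀ a)

  addM-sucˡ : ∀ a b → addM (sM a) b ≡ sM (addM a b)
  addM-sucˡ a b = lower (axioms (base (there (there (there (here refl))))) ρ₀ a b)

  mulM-zeroˡ : ∀ a → mulM zM a ≡ zM
  mulM-zeroˡ a = lower (axioms (base (there (there (there (there (here refl)))))) ρ₀ a)

  mulM-sucˡ : ∀ a b → mulM (sM a) b ≡ addM b (mulM a b)
  mulM-sucˡ a b = lower (axioms (base (there (there (there (there (there (here refl))))))) ρ₀ a b)

  induction : ∀ φ ρ → sat (zM ∷ₑ ρ) φ → (∀ d → sat (d ∷ₑ ρ) φ → sat (sM d ∷ₑ ρ) φ) →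
              ∀ d → sat (d ∷ₑ ρ) φ
  induction φ ρ φ0 step = axioms (ind φ) ρ
    ( proj₂ (sat-inst φ zro) φ0
    , λ d φd → proj₂ (sat-subst φ λ { zero → refl ; (suc n) → refl }) (step d φd) )

  zero-or-suc : ∀ a → Lift _ (a ≡ zM) ∨ₚ Ex D (λ b → Lift _ (a ≡ sM b))
  zero-or-suc = induction ((var 0 == zro) ∨' ∃' (var 1 == S (var 0))) ρ₀
    ∣ inj₁ (lift refl) ∣ (λ a _ → ∣ inj₂ (λ {P} → ∣ a , lift refl ∣) ∣)

  cases : ∀ {b} {B : Set b} a → (a ≡ zM → ∥ B ∥) → (∀ a′ → a ≡ sM a′ → ∥ B ∥) → ∥ B ∥
  cases a z s = ∥∥-bind (zero-or-suc a) λ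
    { (inj₁ (lift a≡0)) → z a≡0
    ; (inj₂ ex)         → ∥∥-bind ex λ (a′ , lift a≡Sa′) → s a′ a≡Sa′ }

  Q-sound : Q⊢ φ → ∀ ρ → sat ρ (φ ᴳ)
  Q-sound d ρ = ᴳ-sound d ρ axiomᴳ
    where
    axiomᴳ : ∀ {ψ} → ψ ∈ Qaxioms → sat ρ (ψ ᴳ)
    axiomᴳ (here refl) a (¬zero , ¬suc) = lift (∥∥-rec-⊥ (zero-or-suc a) λ
      { (inj₁ a≡0) → lower (¬zero λ k → k a≡0)
      ; (inj₂ ex)  → ∥∥-rec-⊥ ex λ (b , a≡Sb) → lower (¬suc λ f → f b λ k → k a≡Sb) })
    axiomᴳ (there m) = sat-horn⇒satᴳ (All.lookup baseAxioms-horn m) ρ (axioms (base m) ρ)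

  addM-identityʳ : ∀ a → addM a zM ≡ a
  addM-identityʳ = λ a → lower (induction (var 0 ⊕ zro == var 0) ρ₀
    (lift (addM-identityˡ zM))
    (λ a (lift ih) → lift (trans (addM-sucˡ a zM) (cong sM ih))) a)

  addM-sucʳ : ∀ a b → addM a (sM b) ≡ sM (addM a b)
  addM-sucʳ a b = lower (induction (∀' (var 1 ⊕ S (var 0) == S (var 1 ⊕ var 0))) ρ₀
    (λ b → lift (trans (addM-identityˡ (sM b)) (cong sM (sym (addM-identityˡ b)))))
    (λ a ih b → lift (trans (addM-sucˡ a (sM b))
                     (trans (cong sM (lower (ih b))) (cong sM (sym (addM-sucˡ a b))))))
    a b)

  mulM-zeroʳ : ∀ a → mulM a zM ≡ zM
  mulM-zeroʳ a = lower (induction (var 0 ⊗ zro == zro) ρ₀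
    (lift (mulM-zeroˡ zM))
    (λ a (lift ih) → lift (trans (mulM-sucˡ a zM) (trans (addM-identityˡ _) ih))) a)

  _≤ᴹ_ : D → D → Set
  a ≤ᴹ b = Σ D λ k → addM a k ≡ b

  ≤ᴹ-total : ∀ a b → ∥ a ≤ᴹ b ⊎ b ≤ᴹ a ∥
  ≤ᴹ-total a b = ∥∥-bind (induction comparable ρ₀ comparable-zero comparable-suc a b) λ
      { (inj₁ ex) → ∥∥-map (λ (k , lift e) → inj₁ (k , e)) ex
      ; (inj₂ ex) → ∥∥-map (λ (k , lift e) → inj₂ (k , e)) ex }
    where
    open ≡-Reasoning
    comparable : Form
    comparable = ∀' (∃' (var 2 ⊕ var 0 == var 1) ∨' ∃' (var 1 ⊕ var 0 == var 2))
    comparable-zero : sat (zM ∷ₑ ρ₀) comparable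
    comparable-zero b = ∣ inj₁ (λ {P} → ∣ b , lift (addM-identityˡ b) ∣) ∣
    comparable-suc : ∀ a → sat (a ∷ₑ ρ₀) comparable → sat (sM a ∷ₑ ρ₀) comparable
    comparable-suc a ih b = ∥∥-bind (ih b) λ
      { (inj₁ ex) → ∥∥-bind ex λ (k , lift a+k≡b) → cases k
          (λ k≡0 → ∣ inj₂ (λ {P} → ∣ sM zM , lift (begin
              addM b (sM zM)  ≡⟨ addM-sucʳ b zM ⟩
              sM (addM b zM)  ≡⟨ cong sM (addM-identityʳ b) ⟩
              sM b            ≡⟨ cong sM (sym a+k≡b) ⟩
              sM (addM a k)   ≡⟨ cong (λ k → sM (addM a k)) k≡0 ⟩
              sM (addM a zM)  ≡⟨ cong sM (addM-identityʳ a) ⟩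
              sM a            ∎) ∣) ∣)
          (λ k′ k≡Sk′ → ∣ inj₁ (λ {P} → ∣ k′ , lift (begin
              addM (sM a) k′  ≡⟨ addM-sucˡ a k′ ⟩
              sM (addM a k′)  ≡⟨ sym (addM-sucʳ a k′) ⟩
              addM a (sM k′)  ≡⟨ cong (addM a) (sym k≡Sk′) ⟩
              addM a k        ≡⟨ a+k≡b ⟩
              b               ∎) ∣) ∣)
      ; (inj₂ ex) → ∥∥-bind ex λ (k , lift b+k≡a) →
          ∣ inj₂ (λ {P} → ∣ sM k , lift (trans (addM-sucʳ b k) (cong sM b+k≡a)) ∣) ∣ }

  ⌜_⌝ : ℕ → D
  ⌜ n ⌝ = numM M n

  eval-num : ∀ ρ n → eval ρ (num n) ≡ ⌜ n ⌝
  eval-num ρ zero    = refl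
  eval-num ρ (suc n) = cong sM (eval-num ρ n)

  ⌜⌝-+ : ∀ m n → addM ⌜ m ⌝ ⌜ n ⌝ ≡ ⌜ m + n ⌝
  ⌜⌝-+ zero    n = addM-identityˡ ⌜ n ⌝
  ⌜⌝-+ (suc m) n = trans (addM-sucˡ ⌜ m ⌝ ⌜ n ⌝) (cong sM (⌜⌝-+ m n))

  ⌜⌝-* : ∀ m n → mulM ⌜ m ⌝ ⌜ n ⌝ ≡ ⌜ m * n ⌝
  ⌜⌝-* zero    n = mulM-zeroˡ ⌜ n ⌝
  ⌜⌝-* (suc m) n = trans (mulM-sucˡ ⌜ m ⌝ ⌜ n ⌝)
                  (trans (cong (addM ⌜ n ⌝) (⌜⌝-* m n)) (⌜⌝-+ n (m * n)))

  ⌜⌝-injective : ∀ {m n} → ⌜ m ⌝ ≡ ⌜ n ⌝ → m ≡ n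
  ⌜⌝-injective {zero}  {zero}  e = refl
  ⌜⌝-injective {zero}  {suc n} e = ⊥-elim (sM≢zM _ (sym e))
  ⌜⌝-injective {suc m} {zero}  e = ⊥-elim (sM≢zM _ e)
  ⌜⌝-injective {suc m} {suc n} e = cong suc (⌜⌝-injective (sM-injective e))

  summandʳ-of-numeral : ∀ k b n → addM ⌜ k ⌝ b ≡ ⌜ n ⌝ → Σ ℕ λ m → k + m ≡ n × ⌜ m ⌝ ≡ b
  summandʳ-of-numeral zero    b n       e = n , refl , trans (sym e) (addM-identityˡ b)
  summandʳ-of-numeral (suc k) b zero    e = ⊥-elim (sM≢zM _ (trans (sym (addM-sucˡ ⌜ k ⌝ b)) e))
  summandʳ-of-numeral (suc k) b (suc n) e
    with summandʳ-of-numeral k b n (sM-injective (trans (sym (addM-sucˡ ⌜ k ⌝ b)) e))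
  ... | m , k+m≡n , ⌜m⌝≡b = m , cong suc k+m≡n , ⌜m⌝≡b

  summandˡ-std : ∀ n a b → addM a b ≡ ⌜ n ⌝ → std M a
  summandˡ-std n a b e = cases a (λ a≡0 → ∣ 0 , sym a≡0 ∣) λ a′ a≡Sa′ →
    below n a′ (trans (sym (addM-sucˡ a′ b)) (trans (cong (λ x → addM x b) (sym a≡Sa′)) e)) a≡Sa′
    where
    below : ∀ n a′ → sM (addM a′ b) ≡ ⌜ n ⌝ → a ≡ sM a′ → std M a
    below zero    a′ e a≡Sa′ = ⊥-elim (sM≢zM _ e)
    below (suc n) a′ e a≡Sa′ =
      ∥∥-map (λ (k , ⌜k⌝≡a′) → suc k , trans (cong sM ⌜k⌝≡a′) (sym a≡Sa′))
             (summandˡ-std n a′ b (sM-injective e))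

  summands-of-numeral : ∀ n a b → addM a b ≡ ⌜ n ⌝ →
                        ∥ Σ ℕ (λ k → Σ ℕ λ m → ⌜ k ⌝ ≡ a × ⌜ m ⌝ ≡ b × k + m ≡ n) ∥
  summands-of-numeral n a b e = ∥∥-map
    (λ { (k , refl) → let (m , k+m≡n , ⌜m⌝≡b) = summandʳ-of-numeral k b n e
                      in k , m , refl , ⌜m⌝≡b , k+m≡n })
    (summandˡ-std n a b e)

  infix 4 _<ᴹ_
  _<ᴹ_ : D → D → Set₁
  a <ᴹ b = Ex D λ k → Lift (lsuc lzero) (addM (sM a) k ≡ b)

  below-numeral : ∀ {u n} → u <ᴹ ⌜ n ⌝ → ∥ Σ ℕ (λ p → ⌜ p ⌝ ≡ u × p < n) ∥
  below-numeral {u} {n} u<n = ∥∥-bind u<n λ (k , lift e) → ∥∥-map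
    (λ { (zero , _ , Sp≡Su , _ , _) → ⊥-elim (sM≢zM u (sym Sp≡Su))
       ; (suc p , m , Sp≡Su , _ , p+m≡n) →
           p , sM-injective Sp≡Su , subst (p <_) p+m≡n (s≤s (m≤m+n p m)) })
    (summands-of-numeral n (sM u) k e)

  factorˡ-of-numeral : ∀ {y} → 1 ≤ y → ∀ p a → mulM a ⌜ y ⌝ ≡ ⌜ p ⌝ →
                       ∥ Σ ℕ (λ x → ⌜ x ⌝ ≡ a × x * y ≡ p) ∥
  factorˡ-of-numeral {y} y≥1 = <-rec LeftFactor λ p rec a e → cases a
    (λ a≡0 → ∣ 0 , sym a≡0 , ⌜⌝-injective (trans (sym (mulM-zeroˡ ⌜ y ⌝))
                                                (trans (cong (λ x → mulM x ⌜ y ⌝) (sym a≡0)) e)) ∣)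
    (λ a′ a≡Sa′ →
      let (z , y+z≡p , ⌜z⌝≡a′y) = summandʳ-of-numeral y _ p
            (trans (sym (mulM-sucˡ a′ ⌜ y ⌝)) (trans (cong (λ x → mulM x ⌜ y ⌝) (sym a≡Sa′)) e))
      in ∥∥-map (λ (x , ⌜x⌝≡a′ , x*y≡z) → suc x , trans (cong sM ⌜x⌝≡a′) (sym a≡Sa′)
                                                  , trans (cong (y +_) x*y≡z) y+z≡p)
                (rec (subst (z <_) y+z≡p (m<n+m z y≥1)) a′ (sym ⌜z⌝≡a′y)))
    where
    LeftFactor : ℕ → Set₁
    LeftFactor p = ∀ a → mulM a ⌜ y ⌝ ≡ ⌜ p ⌝ → ∥ Σ ℕ (λ x → ⌜ x ⌝ ≡ a × x * y ≡ p) ∥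

  factors-of-numeral : ∀ p a b → p ≢ 0 → mulM a b ≡ ⌜ p ⌝ →
                       ∥ Σ ℕ (λ x → Σ ℕ λ y → ⌜ x ⌝ ≡ a × ⌜ y ⌝ ≡ b × x * y ≡ p) ∥
  factors-of-numeral p a b p≢0 e = cases a
    (λ a≡0 → ⊥-elim (p≢0 (⌜⌝-injective
               (trans (sym e) (trans (cong (λ x → mulM x b) a≡0) (mulM-zeroˡ b))))))
    (λ a′ a≡Sa′ → ∥∥-bind (summandˡ-std p b (mulM a′ b)
        (trans (sym (mulM-sucˡ a′ b)) (trans (cong (λ x → mulM x b) (sym a≡Sa′)) e)))
      λ { (y , refl) → with-numeral y e })
    where
    with-numeral : ∀ y → mulM a ⌜ y ⌝ ≡ ⌜ p ⌝ →
                   ∥ Σ ℕ (λ x → Σ ℕ λ y′ → ⌜ x ⌝ ≡ a × ⌜ y′ ⌝ ≡ ⌜ y ⌝ × x * y′ ≡ p) ∥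
    with-numeral zero    e = ⊥-elim (p≢0 (⌜⌝-injective (trans (sym e) (mulM-zeroʳ a))))
    with-numeral (suc y) e = ∥∥-map (λ (x , ⌜x⌝≡a , x*y≡p) → x , suc y , ⌜x⌝≡a , refl , x*y≡p)
                                    (factorˡ-of-numeral (s≤s z≤n) p a e)


  Graph : Form → D → D → Set₁
  Graph ψ x y = sat (x ∷ₑ (y ∷ₑ ρ₀)) (ψ ᴳ)

  computes⇒graph : ∀ ψ n b → Q⊢ (Computes ψ n b) → ∀ d →
                            (Graph ψ ⌜ n ⌝ d → ¬ ¬ ⌜ b ⌝ ≡ d) × (⌜ b ⌝ ≡ d → Graph ψ ⌜ n ⌝ d)
  computes⇒graph ψ n b ⊢rep d =
      (λ g b≢d → lower (proj₁ valid (proj₂ inst g)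
                          λ (lift e) → lift (b≢d (trans (sym (eval-num _ b)) e))))
    , (λ b≡d → proj₁ inst (proj₂ valid λ k → k (lift (trans (eval-num _ b) b≡d))))
    where
    valid = Q-sound ⊢rep ρ₀ d
    inst : sat (d ∷ₑ ρ₀) ((ψ [ num n ]₀) ᴳ) ↔ Graph ψ ⌜ n ⌝ d
    inst = satᴳ-subst ψ λ { zero → eval-num _ n ; (suc k) → refl }

  claims-exclusive : ∀ n → Q⊢ (diagonalClaim n 0) → Q⊢ (diagonalClaim n 1) → ⊥
  claims-exclusive n ⊢0 ⊢1 = proj₁ (computes⇒graph (formAt n) n 1 ⊢1 zM)
    (proj₂ (computes⇒graph (formAt n) n 0 ⊢0 zM) refl) (sM≢zM zM)

  listings-disjoint : ∀ {p} m₀ m₁ → p ≢ 0 → listing 0 m₀ ≡ p → listing 1 m₁ ≡ p → ⊥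
  listings-disjoint m₀ m₁ p≢0 e₀ e₁
    with listing-sound 0 m₀ e₀ p≢0 | listing-sound 1 m₁ e₁ p≢0
  ... | n₀ , P₀ , ⊢0 | n₁ , P₁ , ⊢1 with primeSeq-injective {n₀} {n₁} (trans P₀ (sym P₁))
  ... | refl = claims-exclusive n₀ ⊢0 ⊢1

  isPrimeF : Form
  isPrimeF = ¬' (var 0 == S zro)
          ∧' ∀' (∀' ((var 1 ⊗ var 0 == var 2) ⇒ (var 1 == S zro ∨' var 0 == S zro)))

  IsPrimeᴹ : D → Set₁
  IsPrimeᴹ u = sat (u ∷ₑ ρ₀) isPrimeF

  isPrimeᴹ⇒prime : ∀ p → IsPrimeᴹ ⌜ p ⌝ → Prime p
  isPrimeᴹ⇒prime zero (_ , irreducible) = ⊥-elim (∥∥-rec-⊥ (irreducible zM zM (lift (mulM-zeroˡ zM))) λ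
    { (inj₁ (lift e)) → sM≢zM zM (sym e) ; (inj₂ (lift e)) → sM≢zM zM (sym e) })
  isPrimeᴹ⇒prime (suc zero) (≢1 , _) = ⊥-elim (lower (≢1 (lift refl)))
  isPrimeᴹ⇒prime (suc (suc k)) (_ , irreducible) = prime notComposite
    where
    notComposite : ¬ Composite (suc (suc k))
    notComposite (composite {d} d<n (divides-ℕ q n≡qd)) =
      ∥∥-rec-⊥ (irreducible ⌜ q ⌝ ⌜ d ⌝ (lift (trans (⌜⌝-* q d) (cong ⌜_⌝ (sym n≡qd))))) λ
        { (inj₁ (lift q≡1)) → <-irrefl (trans (sym (*-identityˡ d))
                                 (trans (cong (_* d) (sym (⌜⌝-injective {q} {1} q≡1))) (sym n≡qd))) d<n
        ; (inj₂ (lift d≡1)) → nonTrivial⇒≢1 {d} (⌜⌝-injective d≡1) }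

  prime⇒isPrimeᴹ : ∀ {p} → Prime p → IsPrimeᴹ ⌜ p ⌝
  prime⇒isPrimeᴹ {p} pp = (λ (lift e) → lift (prime≢1 pp (⌜⌝-injective e))) , irreducible
    where
    trivial : ∀ {a b} x y → ⌜ x ⌝ ≡ a → ⌜ y ⌝ ≡ b → x * y ≡ p → Lift _ (a ≡ sM zM) ⊎ Lift _ (b ≡ sM zM)
    trivial x y refl refl x*y≡p with prime⇒irreducible pp (divides-ℕ y (trans (sym x*y≡p) (*-comm x y)))
    ... | inj₁ refl = inj₁ (lift refl)
    ... | inj₂ refl = inj₂ (lift (cong ⌜_⌝ (*-cancelˡ-≡ y 1 p {{prime⇒nonZero pp}}
                                             (trans x*y≡p (sym (*-identityʳ p))))))
    irreducible : ∀ a b → Lift _ (mulM a b ≡ ⌜ p ⌝) → Lift _ (a ≡ sM zM) ∨ₚ Lift _ (b ≡ sM zM)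
    irreducible a b (lift e) = ∥∥-map (λ (x , y , ex , ey , exy) → trivial x y ex ey exy)
                                      (factors-of-numeral p a b (prime≢0 pp) e)

  infix 4 _∣ᴹ_
  _∣ᴹ_ : D → D → Set₁
  a ∣ᴹ b = Ex D λ k → Lift (lsuc lzero) (mulM a k ≡ b)

  divides↔∣ᴹ : ∀ n d → divides M n d ↔ (⌜ n ⌝ ∣ᴹ d)
  divides↔∣ᴹ n d =
      ∥∥-map (λ (k , lift e) → k , lift (trans (cong (λ x → mulM x k) (sym (eval-num _ n))) e))
    , ∥∥-map (λ (k , lift e) → k , lift (trans (cong (λ x → mulM x k) (eval-num _ n)) e))

  ∣⇒∣ᴹ : ∀ {p c} → p ∣ c → ⌜ p ⌝ ∣ᴹ ⌜ c ⌝
  ∣⇒∣ᴹ {p} (divides-ℕ q c≡qp) =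
    ∣ ⌜ q ⌝ , lift (trans (⌜⌝-* p q) (cong ⌜_⌝ (trans (*-comm p q) (sym c≡qp)))) ∣

  ∣ᴹ⇒∣ : ∀ {p c} → c ≢ 0 → ⌜ p ⌝ ∣ᴹ ⌜ c ⌝ → ∥ p ∣ c ∥
  ∣ᴹ⇒∣ {p} {c} c≢0 p∣c = ∥∥-bind p∣c λ (w , lift e) → ∥∥-map
    (λ (x , y , ⌜x⌝≡⌜p⌝ , _ , x*y≡c) →
      divides-ℕ y (trans (sym x*y≡c) (trans (cong (_* y) (⌜⌝-injective {x} {p} ⌜x⌝≡⌜p⌝)) (*-comm p y))))
    (factors-of-numeral c ⌜ p ⌝ w c≢0 e)

  numeral<nonstandard : ∀ {y} → ¬ std M y → ∀ n → ⌜ n ⌝ <ᴹ y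
  numeral<nonstandard {y} ¬std n = ∥∥-bind (≤ᴹ-total (sM ⌜ n ⌝) y) λ
    { (inj₁ (k , e)) → ∣ k , lift e ∣
    ; (inj₂ (k , e)) → ⊥-elim (¬std (summandˡ-std (suc n) y k e)) }

  -- If no nonstandard element had the property, every element having it would be a numeral, so
  -- induction would carry it from each element to its successor, and so to the nonstandard e.
  overspill : ∀ χ → (∀ n → sat (⌜ n ⌝ ∷ₑ ρ₀) (¬' χ)) → nonstandard M →
              ¬ ¬ Σ D λ y → ¬ std M y × sat (y ∷ₑ ρ₀) (¬' χ)
  overspill χ at-numerals e-nonstd none =
    ∥∥-rec-⊥ e-nonstd λ (e , ¬std) → none (e , ¬std , everywhere e)
    where
    everywhere : ∀ y → sat (y ∷ₑ ρ₀) (¬' χ)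
    everywhere = induction (¬' χ) ρ₀ (at-numerals 0) λ y ¬χy χSy →
      lift (none (y , (λ std-y → ∥∥-rec-⊥ std-y λ (m , ⌜m⌝≡y) →
        lower (subst (λ z → sat (sM z ∷ₑ ρ₀) (¬' χ)) ⌜m⌝≡y (at-numerals (suc m)) χSy)) , ¬χy))

-- Separating the listings inside a model

module Separation (M : HAModel) (φ₀ φ₁ : Form)
                  (rep₀ : Represents (listing 0) φ₀) (rep₁ : Represents (listing 1) φ₁) where
  open Model M

  Θ : D → Set₁
  Θ a = Ex D λ m → Graph φ₀ m a × (∀ j → j ≤ᴹ m → ¬ Graph φ₁ j a)

  -- Sending the variables beyond the two arguments to 0 makes θ independent of the environment.
  θ : Form
  θ = ∃' ((φ₀ ᴳ) [ var 0 ∷ₛ (var 1 ∷ₛ λ _ → zro) ]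
         ∧' ∀' (∃' (var 1 ⊕ var 0 == var 2) ⇒ ¬' ((φ₁ ᴳ) [ var 0 ∷ₛ (var 2 ∷ₛ λ _ → zro) ])))

  sat-θ↔Θ : ∀ a ρ → sat (a ∷ₑ ρ) θ ↔ Θ a
  sat-θ↔Θ a ρ =
      ∥∥-map (λ (m , g₀ , f) → m , proj₁ (graph₀ m) g₀ ,
                λ j (k , e) g₁ → lower (f j ∣ k , lift e ∣ (proj₂ (graph₁ j m) g₁)))
    , ∥∥-map (λ (m , g₀ , f) → m , proj₂ (graph₀ m) g₀ ,
                λ j j≤m g₁ → lift (∥∥-rec-⊥ j≤m λ (k , lift e) → f j (k , e) (proj₁ (graph₁ j m) g₁)))
    where
    graph₀ : ∀ m → sat (m ∷ₑ (a ∷ₑ ρ)) ((φ₀ ᴳ) [ var 0 ∷ₛ (var 1 ∷ₛ λ _ → zro) ]) ↔ Graph φ₀ m a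
    graph₀ m = sat-subst (φ₀ ᴳ) λ { zero → refl ; (suc zero) → refl ; (suc (suc _)) → refl }
    graph₁ : ∀ j m → sat (j ∷ₑ (m ∷ₑ (a ∷ₑ ρ))) ((φ₁ ᴳ) [ var 0 ∷ₛ (var 2 ∷ₛ λ _ → zro) ]) ↔ Graph φ₁ j a
    graph₁ j m = sat-subst (φ₁ ᴳ) λ { zero → refl ; (suc zero) → refl ; (suc (suc _)) → refl }

  listed₀⇒Θ : ∀ {p} m → p ≢ 0 → listing 0 m ≡ p → Θ ⌜ p ⌝
  listed₀⇒Θ {p} m p≢0 e = ∣ ⌜ m ⌝ , proj₂ (computes⇒graph φ₀ m _ (rep₀ m) ⌜ p ⌝) (cong ⌜_⌝ e) , earlier ∣
    where
    earlier : ∀ j → j ≤ᴹ ⌜ m ⌝ → ¬ Graph φ₁ j ⌜ p ⌝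
    earlier j (k , e′) g₁ = ∥∥-rec-⊥ (summandˡ-std m j k e′) λ { (j′ , refl) →
      proj₁ (computes⇒graph φ₁ j′ _ (rep₁ j′) ⌜ p ⌝) g₁ λ l₁≡p →
        listings-disjoint m j′ p≢0 e (⌜⌝-injective l₁≡p) }

  listed₁⇒¬Θ : ∀ {p} m → p ≢ 0 → listing 1 m ≡ p → ¬ Θ ⌜ p ⌝
  listed₁⇒¬Θ {p} m₁ p≢0 e₁ Θp = ∥∥-rec-⊥ Θp λ (m , g₀ , f) → ∥∥-rec-⊥ (≤ᴹ-total m ⌜ m₁ ⌝) λ
    { (inj₁ (k , e)) → ∥∥-rec-⊥ (summandˡ-std m₁ m k e) λ { (m₀ , refl) →
        proj₁ (computes⇒graph φ₀ m₀ _ (rep₀ m₀) ⌜ p ⌝) g₀ λ l₀≡p →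
          listings-disjoint m₀ m₁ p≢0 (⌜⌝-injective l₀≡p) e₁ }
    ; (inj₂ m₁≤m) → f ⌜ m₁ ⌝ m₁≤m (proj₂ (computes⇒graph φ₁ m₁ _ (rep₁ m₁) ⌜ p ⌝) (cong ⌜_⌝ e₁)) }

  ¬¬θ↔¬¬Θ : ∀ a ρ → sat (a ∷ₑ ρ) (¬' (¬' θ)) ↔ (¬ ¬ Θ a)
  ¬¬θ↔¬¬Θ a ρ = (λ ¬¬θ ¬Θ → lower (¬¬θ λ θa → lift (¬Θ (proj₁ (sat-θ↔Θ a ρ) θa))))
               , (λ ¬¬Θ ¬θ → lift (¬¬Θ λ Θa → lower (¬θ (proj₂ (sat-θ↔Θ a ρ) Θa))))

  CodesAt : D → D → Set₁
  CodesAt c u = (¬ ¬ Θ u → u ∣ᴹ c) × (u ∣ᴹ c → ¬ ¬ Θ u)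

  -- c codes ¬¬θ on the primes below y (variables: c = 0, y = 1)
  codeF : Form
  codeF = ∀' (∃' (S (var 1) ⊕ var 0 == var 3) ⇒ isPrimeF ⇒ (¬' (¬' θ) ⇔ ∃' (var 1 ⊗ var 0 == var 2)))

  sat-codeF↔ : ∀ c y ρ → sat (c ∷ₑ (y ∷ₑ ρ)) codeF ↔ (∀ u → u <ᴹ y → IsPrimeᴹ u → CodesAt c u)
  sat-codeF↔ c y ρ =
      (λ code u u<y u-prime → let (to , from) = code u u<y u-prime in
          (λ ¬¬Θu → to (proj₂ (¬¬θ↔¬¬Θ u _) ¬¬Θu)) , (λ u∣c → proj₁ (¬¬θ↔¬¬Θ u _) (from u∣c)))
    , (λ codes u u<y u-prime → let (to , from) = codes u u<y u-prime in
          (λ ¬¬θu → to (proj₁ (¬¬θ↔¬¬Θ u _) ¬¬θu)) , (λ u∣c → proj₂ (¬¬θ↔¬¬Θ u _) (from u∣c)))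

  CodesAt-std : ∀ {P : ℕ → Set} {c u} → ∥ Σ ℕ (λ p → ⌜ p ⌝ ≡ u × P p) ∥ →
                (∀ p → ⌜ p ⌝ ≡ u → P p → CodesAt c ⌜ p ⌝) → CodesAt c u
  CodesAt-std {c = c} std-u at =
      (λ ¬¬Θu → ∥∥-bind std-u λ (p , e , Pp) →
                  subst (_∣ᴹ c) e (proj₁ (at p e Pp) (subst (λ x → ¬ ¬ Θ x) (sym e) ¬¬Θu)))
    , (λ u∣c ¬Θu → ∥∥-rec-⊥ std-u λ (p , e , Pp) →
                  proj₂ (at p e Pp) (subst (_∣ᴹ c) (sym e) u∣c) (subst (λ x → ¬ Θ x) (sym e) ¬Θu))

  numeral-code : ∀ {n c} → PrimeCode (λ p → Θ ⌜ p ⌝) n c →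
                 ∀ u → u <ᴹ ⌜ n ⌝ → IsPrimeᴹ u → CodesAt ⌜ c ⌝ u
  numeral-code {n} {c} code u u<n u-prime =
    CodesAt-std (below-numeral u<n) λ p ⌜p⌝≡u p<n →
      let pp = isPrimeᴹ⇒prime p (subst IsPrimeᴹ (sym ⌜p⌝≡u) u-prime)
      in (λ ¬¬Θp → ∣⇒∣ᴹ (proj₁ (codes p p<n pp) ¬¬Θp))
       , (λ p∣c ¬Θp → ∥∥-rec-⊥ (∣ᴹ⇒∣ nonZero p∣c) λ p∣c → proj₂ (codes p p<n pp) p∣c ¬Θp)
    where open PrimeCode code

  codableF : Form
  codableF = ¬' (¬' (∃' codeF))

  codable-at-numerals : ∀ n → sat (⌜ n ⌝ ∷ₑ ρ₀) codableF
  codable-at-numerals n ¬code = lift (¬¬-primeCode (λ p → Θ ⌜ p ⌝) n λ (c , code) →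
    lower (¬code ∣ ⌜ c ⌝ , proj₂ (sat-codeF↔ ⌜ c ⌝ ⌜ n ⌝ ρ₀) (numeral-code code) ∣))

  ¬¬-code : nonstandard M → ¬ ¬ Σ D λ c → ∀ p → Prime p → CodesAt c ⌜ p ⌝
  ¬¬-code nonstd ¬code = overspill (¬' (∃' codeF)) codable-at-numerals nonstd λ (y , ¬std , codable) →
    lower (codable λ ∃code → lift (∥∥-rec-⊥ ∃code λ (c , code) → ¬code (c , λ p pp →
      proj₁ (sat-codeF↔ c y ρ₀) code ⌜ p ⌝ (numeral<nonstandard ¬std p) (prime⇒isPrimeᴹ pp))))

  code⇒undecidable : CT-Q → ∀ {c} → (∀ p → Prime p → CodesAt c ⌜ p ⌝) → ¬ Decₚ (λ n → divides M n c)
  code⇒undecidable ct {c} codes dec = ∥∥-rec-⊥ dec λ (f , f-spec) →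
    ∥∥-rec-⊥ (ct (divBit f)) λ (φ , _ , _ , rep) → let (i , formAt-i≡φ) = formAt-surjective φ in
      diagonal f (λ n → (λ n∣c → proj₁ (f-spec n) (proj₂ (divides↔∣ᴹ n c) n∣c))
                      , (λ fn → proj₁ (divides↔∣ᴹ n c) (proj₂ (f-spec n) fn))) i
        (subst (λ ψ → Q⊢ (Computes ψ i (divBit f i))) (sym formAt-i≡φ) (rep i))
    where
    divBit : (ℕ → Bool) → ℕ → ℕ
    divBit f n = if f (primeSeq n) then 1 else 0

    diagonal : ∀ f → (∀ n → (⌜ n ⌝ ∣ᴹ c) ↔ (f n ≡ true)) → ∀ i → Q⊢ (diagonalClaim i (divBit f i)) → ⊥
    diagonal f f-spec i ⊢claim with f (primeSeq i) in fPᵢ≡b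
    ... | true  = let (m , listed) = listing-complete 1 i ⊢claim in
      proj₂ (codes _ (primeSeq-prime i)) (proj₂ (f-spec _) fPᵢ≡b) (listed₁⇒¬Θ m (primeSeq≢0 i) listed)
    ... | false = let (m , listed) = listing-complete 0 i ⊢claim in
      true≢false (trans (sym (proj₁ (f-spec _) (proj₁ (codes _ (primeSeq-prime i))
                                   λ ¬Θ → ¬Θ (listed₀⇒Θ m (primeSeq≢0 i) listed)))) fPᵢ≡b)
      where
      true≢false : true ≢ false
      true≢false ()

theorem7p21 : CT-Q → (M : HAModel) → nonstandard M →
    ¬ ¬ Ex (HAModel.D M) (λ d → ¬ Decₚ (λ (n : _) → divides M n d))
theorem7p21 ct M nonstd no-witness =
  ∥∥-rec-⊥ (ct (listing 0)) λ (φ₀ , _ , _ , rep₀) →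
  ∥∥-rec-⊥ (ct (listing 1)) λ (φ₁ , _ , _ , rep₁) →
  let open Separation M φ₀ φ₁ rep₀ rep₁ in
  ¬¬-code nonstd λ (c , codes) → no-witness ∣ c , code⇒undecidable ct codes ∣
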